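{- Let $(I,C)$ be a hypergraph equipped with Plott choice functions $f_i$ on $C(i)$, $i\in I$. Fix an agent $0\in I$ and suppose $f_0=f_1\cup f_2$ with $f_1,f_2$ Plott choice functions on $C(0)$. Build $(\widetilde I,\widetilde C)$ with choice functions $\widetilde f$ as follows: $\widetilde I=(I\setminus\{0\})\cup\{1,2\}$ with $1,2$ new agents; $\widetilde C=(C\setminus C(0))\sqcup(C(0)\times\{1\})\sqcup(C(0)\times\{2\})$, where $c\in C\setminus C(0)$ keeps its participants and $c_k=(c,k)$ ($c\in C(0)$, $k=1,2$) has participants $(P(c)\setminus\{0\})\cup\{k\}$; $\pi:\widetilde C\to C$ is $\pi(c)=c$ for $c\notin C(0)$, $\pi(c_k)=c$; agent $k\in\{1,2\}$ uses $f_k$ on $C(0)\times\{k\}\cong C(0)$; every $j\in I\setminus\{0\}$ uses $\widetilde f_j(A)=A\cap\pi^{ -1}(f_j(\pi(A)))$ for $A\subseteq\widetilde C(j)$. Let $S\subseteq C$ be a stable system and define $\widetilde S\subseteq\widetilde C$ to consist of all contracts of $S\setminus C(0)$ together with $f_1(S(0))\times\{1\}$ and $f_2(S(0))\times\{2\}$. Then $\widetilde S$ is a stable system in $(\widetilde I,\widetilde C)$.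
   Context: A hypergraph $(I,C)$: finite agents $I$, finite contracts $C$, each $c$ with a nonempty participant set $P(c)\subseteq I$; $S(i)=\{s\in S:i\in P(s)\}$. A choice function on a finite set $X$ is a map $f:2^X\to2^X$ with $f(A)\subseteq A$; it is Plott if $f(A\cup B)=f(f(A)\cup B)$ for all $A,B$; $(f_1\cup f_2)(A)=f_1(A)\cup f_2(A)$. A system $S$ is stable if (S0) $f_i(S(i))=S(i)$ for all agents $i$, and (S*) for every contract $b\notin S$ there is $i\in P(b)$ with $b\notin f_i(S(i)\cup\{b\})$ (analogously in $(\widetilde I,\widetilde C)$ with the $\widetilde f$). -}

module Defs where

open import Data.Bool using (Bool; true; false; _∧_; _∨_; not; T; if_then_else_)
open import Data.Nat using (ℕ)
open import Data.Fin using (Fin)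
open import Data.Product using (Σ; ∃; _×_; _,_; proj₁)
open import Data.Sum using (_⊎_; inj₁; inj₂)
open import Function.Bundles using (_↔_)
open import Relation.Binary.PropositionalEquality using (_≡_; refl; cong)
open import Relation.Nullary using (yes; no)
open import Data.Sum.Properties using (≡-dec)
open import Data.Product.Properties using () renaming (≡-dec to ≡-dec×)
open import Relation.Binary.Definitions using (DecidableEquality)
open import Relation.Nullary.Decidable using (⌊_⌋)

Sub : Set → Set
Sub X = X → Bool

infix 4 _∈_ _⊆_ _≐_
infixr 6 _∩_
infixr 5 _∪_

_∈_ : {X : Set} → X → Sub X → Set
x ∈ A = A x ≡ true

_⊆_ : {X : Set} → Sub X → Sub X → Set
A ⊆ B = ∀ x → x ∈ A → x ∈ B

_≐_ : {X : Set} → Sub X → Sub X → Set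
A ≐ B = ∀ x → A x ≡ B x

_∪_ : {X : Set} → Sub X → Sub X → Sub X
(A ∪ B) x = A x ∨ B x

_∩_ : {X : Set} → Sub X → Sub X → Sub X
(A ∩ B) x = A x ∧ B x

⁅_⁆ : {X : Set} → DecidableEquality X → X → Sub X
⁅ _≟_ ⁆ b x = ⌊ x ≟ b ⌋

IsFinite : Set → Set
IsFinite X = Σ ℕ λ n → X ↔ Fin n

-- A map f : 2^D → 2^D is encoded
-- as f : Sub X → Sub X, of which only the values on subsets of D matter.
-- Since subsets are predicates, f must respect extensional equality
-- (this is automatic for maps on sets).

record IsChoiceFunctionOn {X : Set} (D : Sub X) (f : Sub X → Sub X) : Set where
  field
    respects-≐  : ∀ A B → A ⊆ D → B ⊆ D → A ≐ B → f A ≐ f B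
    contracting : ∀ A → A ⊆ D → f A ⊆ A

record IsPlottOn {X : Set} (D : Sub X) (f : Sub X → Sub X) : Set where
  field
    isChoiceFunction : IsChoiceFunctionOn D f
    plott : ∀ A B → A ⊆ D → B ⊆ D → f (A ∪ B) ≐ f (f A ∪ B)

_at_ : {I C : Set} → (C → Sub I) → Sub C → I → Sub C
(P at S) i c = S c ∧ P c i

record Stable {I C : Set} (_≟_ : DecidableEquality C) (P : C → Sub I)
              (f : I → Sub C → Sub C) (S : Sub C) : Set where
  field
    S0    : ∀ i → f i ((P at S) i) ≐ (P at S) i
    Sstar : ∀ b → S b ≡ false →
            ∃ λ i → P b i ≡ true × f i ((P at S) i ∪ ⁅ _≟_ ⁆ b) b ≡ false

data Copy : Set where
  one two : Copy

_==ᶜ_ : Copy → Copy → Bool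
one ==ᶜ one = true
two ==ᶜ two = true
_   ==ᶜ _   = false

T-irrelevant : ∀ {b} (p q : T b) → p ≡ q
T-irrelevant {true} _ _ = refl

Copy-≟ : DecidableEquality Copy
Copy-≟ one one = yes refl
Copy-≟ one two = no λ ()
Copy-≟ two one = no λ ()
Copy-≟ two two = yes refl

Σ-T-≟ : {C : Set} (Q : Sub C) → DecidableEquality C → DecidableEquality (Σ C λ c → T (Q c))
Σ-T-≟ Q _≟_ (c , p) (d , q) with c ≟ d
... | yes refl = yes (cong (c ,_) (T-irrelevant p q))
... | no c≢d   = no λ e → c≢d (cong proj₁ e)

module Split {I C : Set} (_≟ᴵ_ : DecidableEquality I) (_≟ᶜ_ : DecidableEquality C)
             (P : C → Sub I) (o : I)
             (f : I → Sub C → Sub C)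
             (f₁ f₂ : Sub C → Sub C) where

  fk : Copy → Sub C → Sub C
  fk one = f₁
  fk two = f₂

  C0 : Sub C
  C0 c = P c o

  Ĩ : Set
  Ĩ = (Σ I λ j → T (not ⌊ j ≟ᴵ o ⌋)) ⊎ Copy

  C̃ : Set
  C̃ = (Σ C λ c → T (not (C0 c))) ⊎ ((Σ C λ c → T (C0 c)) × Copy)

  C̃-≟ : DecidableEquality C̃
  C̃-≟ = ≡-dec (Σ-T-≟ (λ c → not (C0 c)) _≟ᶜ_) (≡-dec× (Σ-T-≟ C0 _≟ᶜ_) Copy-≟)

  π : C̃ → C
  π (inj₁ (c , _))     = c
  π (inj₂ ((c , _) , _)) = c

  P̃ : C̃ → Sub Ĩ
  P̃ (inj₁ (c , _))       (inj₁ (j , _)) = P c j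
  P̃ (inj₁ (c , _))       (inj₂ k)       = false
  P̃ (inj₂ ((c , _) , _)) (inj₁ (j , _)) = P c j
  P̃ (inj₂ ((c , _) , k)) (inj₂ k′)      = k ==ᶜ k′

  πimg : Sub C̃ → Sub C
  πimg A c with C0 c in eq
  ... | true  = A (inj₂ ((c , Tsub eq) , one)) ∨ A (inj₂ ((c , Tsub eq) , two))
    where
    Tsub : ∀ {b} → b ≡ true → T b
    Tsub refl = _
  ... | false = A (inj₁ (c , Tsub eq))
    where
    Tsub : ∀ {b} → b ≡ false → T (not b)
    Tsub refl = _

  πpre : Sub C → Sub C̃
  πpre B x = B (π x)

  f̃ : Ĩ → Sub C̃ → Sub C̃
  f̃ (inj₁ (j , _)) A = A ∩ πpre (f j (πimg A))
  f̃ (inj₂ k) A (inj₁ _)              = false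
  f̃ (inj₂ k) A (inj₂ ((c , _) , k′)) = (k ==ᶜ k′) ∧ fk k (πimg A) c

  S̃ : Sub C → Sub C̃
  S̃ S (inj₁ (c , _))       = S c
  S̃ S (inj₂ ((c , _) , k)) = fk k ((P at S) o) c

-- Write S₀ = S(0). Stability of S gives f₁(S₀) ∪ f₂(S₀) = f₀(S₀) = S₀, so π maps S̃(j) onto
-- S(j) for every old agent j ≠ 0, and S̃(k) onto f_k(S₀), a fixed point of f_k since Plott
-- choice functions are idempotent. Let b ∉ S̃. If π b ∈ S, then b = c_k with
-- c ∉ f_k(S₀ ∪ {c}) = f_k(S₀), and agent k blocks b. Otherwise some agent i blocks π b against
-- S; if i ≠ 0 then i blocks b, and if i = 0 then c ∉ f_k(S₀ ∪ {c}) = f_k(f_k(S₀) ∪ {c}) by the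
-- Plott property, so agent k blocks b.
module Submission where

open import Defs
open import Algebra.Bundles using (CommutativeMonoid)
open import Data.Bool using (Bool; true; false; _∧_; _∨_; not; T)
open import Data.Bool.Properties
  using (∧-zeroʳ; ∧-identityʳ; ∨-identityʳ; ∨-zeroʳ; ∧-distribʳ-∨; ∧-conicalˡ; ∧-conicalʳ;
         ∨-conicalˡ; ∨-conicalʳ; T-≡; ∨-commutativeMonoid)
open import Data.Empty using (⊥; ⊥-elim)
open import Data.Product using (∃; _×_; _,_)
open import Data.Sum using (inj₁; inj₂)
open import Data.Unit using (⊤; tt)
open import Function.Base using (_∋_; const)
open import Function.Bundles using (Equivalence)
open import Relation.Binary.Definitions using (DecidableEquality)
open import Relation.Binary.PropositionalEquality
  using (_≡_; refl; sym; trans; cong; cong₂; subst; module ≡-Reasoning)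
open import Relation.Nullary using (Dec; ¬_; yes; no)
open import Relation.Nullary.Decidable
  using (⌊_⌋; isYes≗does; dec-true; dec-false; fromWitnessFalse)
open import Algebra.Properties.CommutativeSemigroup
  (CommutativeMonoid.commutativeSemigroup ∨-commutativeMonoid) using (interchange)

⌊⌋-true : {A : Set} (a? : Dec A) → A → ⌊ a? ⌋ ≡ true
⌊⌋-true a? a = trans (isYes≗does a?) (dec-true a? a)

⌊⌋-false : {A : Set} (a? : Dec A) → ¬ A → ⌊ a? ⌋ ≡ false
⌊⌋-false a? ¬a = trans (isYes≗does a?) (dec-false a? ¬a)

T-not-T : ∀ {b} → T b → T (not b) → ⊥
T-not-T {true} _ ()

data Side (b : Bool) : Set where
  inside  : T b → Side b
  outside : T (not b) → Side b

side : ∀ b → Side b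
side true  = inside tt
side false = outside tt

module _ {X : Set} where

  ⊆-respˡ-≐ : {A B D : Sub X} → A ≐ B → B ⊆ D → A ⊆ D
  ⊆-respˡ-≐ A≐B B⊆D x x∈A = B⊆D x (trans (sym (A≐B x)) x∈A)

  ∪-least : {A B D : Sub X} → A ⊆ D → B ⊆ D → A ∪ B ⊆ D
  ∪-least {A} A⊆D B⊆D x x∈A∪B with A x in Ax
  ... | true  = A⊆D x Ax
  ... | false = B⊆D x x∈A∪B

  ⊆⇒∩≐ : {A B : Sub X} → A ⊆ B → A ∩ B ≐ A
  ⊆⇒∩≐ {A} A⊆B x with A x in Ax
  ... | true  = A⊆B x Ax
  ... | false = refl

  module _ (_≟_ : DecidableEquality X) where

    x∈D⇒⁅x⁆⊆D : {D : Sub X} {x : X} → x ∈ D → ⁅ _≟_ ⁆ x ⊆ D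
    x∈D⇒⁅x⁆⊆D {x = x} x∈D y y∈⁅x⁆ with y ≟ x
    ... | yes refl = x∈D

    x∈A⇒A∪⁅x⁆≐A : {A : Sub X} {x : X} → x ∈ A → A ∪ ⁅ _≟_ ⁆ x ≐ A
    x∈A⇒A∪⁅x⁆≐A {A} {x} x∈A y with y ≟ x
    ... | yes refl = trans (∨-zeroʳ (A y)) (sym x∈A)
    ... | no _     = ∨-identityʳ (A y)

module ChoiceFunctionOn {X : Set} {D : Sub X} {f : Sub X → Sub X}
                        (cf : IsChoiceFunctionOn D f) where
  open IsChoiceFunctionOn cf

  f-cong : {A B : Sub X} → A ≐ B → B ⊆ D → f A ≐ f B
  f-cong {A} {B} A≐B B⊆D = respects-≐ A B (⊆-respˡ-≐ A≐B B⊆D) B⊆D A≐B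

  f⊆D : {A : Sub X} → A ⊆ D → f A ⊆ D
  f⊆D {A} A⊆D x x∈fA = A⊆D x (contracting A A⊆D x x∈fA)

module PlottOn {X : Set} {D : Sub X} {f : Sub X → Sub X} (pl : IsPlottOn D f) where
  open IsPlottOn pl
  open IsChoiceFunctionOn isChoiceFunction using (contracting) public
  open ChoiceFunctionOn isChoiceFunction public

  f-idem : {A : Sub X} → A ⊆ D → f (f A) ≐ f A
  f-idem {A} A⊆D x = begin
    f (f A) x         ≡⟨ f-cong (λ y → ∨-identityʳ (f A y)) (f⊆D A⊆D) x ⟨
    f (f A ∪ ∅) x     ≡⟨ plott A ∅ A⊆D (λ _ ()) x ⟨
    f (A ∪ ∅) x       ≡⟨ f-cong (λ y → ∨-identityʳ (A y)) A⊆D x ⟩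
    f A x             ∎
    where
    open ≡-Reasoning
    ∅ : Sub X
    ∅ _ = false

==ᶜ-refl : ∀ k → (k ==ᶜ k) ≡ true
==ᶜ-refl one = refl
==ᶜ-refl two = refl

module SplitProperties {I C : Set} (_≟ᴵ_ : DecidableEquality I) (_≟ᶜ_ : DecidableEquality C)
                  (P : C → Sub I) (o : I) (f : I → Sub C → Sub C)
                  (f₁ f₂ : Sub C → Sub C) where
  open Split _≟ᴵ_ _≟ᶜ_ P o f f₁ f₂

  copy : (c : C) → T (C0 c) → Copy → C̃
  copy c p k = inj₂ ((c , p) , k)

  -- In both lemmas the detour through g : ⊤ → C keeps the type of p, which mentions g tt,
  -- apart from the abstracted C0 (g u); a with-abstraction over C0 c itself is ill-typed.
  πimg-inside : ∀ A c (p : T (C0 c)) → πimg A c ≡ A (copy c p one) ∨ A (copy c p two)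
  πimg-inside A c = go (const c) tt
    where
    go : (g : ⊤ → C) (u : ⊤) (p : T (C0 (g tt))) →
         πimg A (g u) ≡ A (copy (g tt) p one) ∨ A (copy (g tt) p two)
    go g u p with C0 (g u) | (C0 (g tt) ≡ C0 (g u)) ∋ refl
    ... | true  | _ = cong (λ q → A (copy (g tt) q one) ∨ A (copy (g tt) q two)) (T-irrelevant _ p)
    ... | false | e = ⊥-elim (subst T e p)

  πimg-outside : ∀ A c (p : T (not (C0 c))) → πimg A c ≡ A (inj₁ (c , p))
  πimg-outside A c = go (const c) tt
    where
    go : (g : ⊤ → C) (u : ⊤) (p : T (not (C0 (g tt)))) → πimg A (g u) ≡ A (inj₁ (g tt , p))
    go g u p with C0 (g u) | (C0 (g tt) ≡ C0 (g u)) ∋ refl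
    ... | false | _ = cong (λ q → A (inj₁ (g tt , q))) (T-irrelevant _ p)
    ... | true  | e = ⊥-elim (subst (λ b → T (not b)) e p)

  πimg-∪ : ∀ A B → πimg (A ∪ B) ≐ πimg A ∪ πimg B
  πimg-∪ A B c with side (C0 c)
  ... | inside p = begin
    πimg (A ∪ B) c                 ≡⟨ πimg-inside (A ∪ B) c p ⟩
    (A c₁ ∨ B c₁) ∨ (A c₂ ∨ B c₂)  ≡⟨ interchange (A c₁) (B c₁) (A c₂) (B c₂) ⟩
    (A c₁ ∨ A c₂) ∨ (B c₁ ∨ B c₂)  ≡⟨ cong₂ _∨_ (πimg-inside A c p) (πimg-inside B c p) ⟨
    πimg A c ∨ πimg B c            ∎
    where
    open ≡-Reasoning
    c₁ c₂ : C̃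
    c₁ = copy c p one
    c₂ = copy c p two
  ... | outside p =
    trans (πimg-outside (A ∪ B) c p) (sym (cong₂ _∨_ (πimg-outside A c p) (πimg-outside B c p)))

  πimg-⁅⁆ : ∀ b → πimg (⁅ C̃-≟ ⁆ b) ≐ ⁅ _≟ᶜ_ ⁆ (π b)
  πimg-⁅⁆ b c with c ≟ᶜ π b
  πimg-⁅⁆ b c | no c≢πb with side (C0 c)
  ... | inside p  =
    trans (πimg-inside _ c p) (cong₂ _∨_ (miss (copy c p one) refl) (miss (copy c p two) refl))
    where
    miss : ∀ x → π x ≡ c → ⌊ C̃-≟ x b ⌋ ≡ false
    miss x πx≡c = ⌊⌋-false (C̃-≟ x b) (λ x≡b → c≢πb (trans (sym πx≡c) (cong π x≡b)))
  ... | outside p = trans (πimg-outside _ c p)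
                      (⌊⌋-false (C̃-≟ (inj₁ (c , p)) b) (λ e → c≢πb (cong π e)))
  πimg-⁅⁆ (inj₁ (c , n)) .c | yes refl with side (C0 c)
  ... | inside p  = ⊥-elim (T-not-T p n)
  ... | outside p = trans (πimg-outside _ c p)
                      (⌊⌋-true (C̃-≟ (inj₁ (c , p)) (inj₁ (c , n)))
                               (cong (λ q → inj₁ (c , q)) (T-irrelevant p n)))
  πimg-⁅⁆ (inj₂ ((c , p′) , k)) .c | yes refl with side (C0 c)
  ... | outside p = ⊥-elim (T-not-T p′ p)
  ... | inside p  = trans (πimg-inside _ c p) (hit k)
    where
    hit′ : ∀ k → ⌊ C̃-≟ (copy c p k) (copy c p′ k) ⌋ ≡ true
    hit′ k = ⌊⌋-true (C̃-≟ (copy c p k) (copy c p′ k)) (cong (λ q → copy c q k) (T-irrelevant p p′))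
    hit : ∀ k → ⌊ C̃-≟ (copy c p one) (copy c p′ k) ⌋ ∨ ⌊ C̃-≟ (copy c p two) (copy c p′ k) ⌋ ≡ true
    hit one = cong (_∨ ⌊ C̃-≟ (copy c p two) (copy c p′ one) ⌋) (hit′ one)
    hit two = trans (cong (⌊ C̃-≟ (copy c p one) (copy c p′ two) ⌋ ∨_) (hit′ two)) (∨-zeroʳ _)

  P̃-old : ∀ b j (j≢o : T (not ⌊ j ≟ᴵ o ⌋)) → P̃ b (inj₁ (j , j≢o)) ≡ P (π b) j
  P̃-old (inj₁ _) _ _ = refl
  P̃-old (inj₂ _) _ _ = refl

module SplitOfStable {I C : Set} (_≟ᴵ_ : DecidableEquality I) (_≟ᶜ_ : DecidableEquality C)
                     (P : C → Sub I) (f : I → Sub C → Sub C)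
                     (f-plott : ∀ i → IsPlottOn (λ c → P c i) (f i))
                     (o : I) (f₁ f₂ : Sub C → Sub C)
                     (f₁-plott : IsPlottOn (λ c → P c o) f₁)
                     (f₂-plott : IsPlottOn (λ c → P c o) f₂)
                     (f₀≐f₁∪f₂ : ∀ A → A ⊆ (λ c → P c o) → f o A ≐ f₁ A ∪ f₂ A)
                     (S : Sub C) (S-stable : Stable _≟ᶜ_ P f S) where
  open Split _≟ᴵ_ _≟ᶜ_ P o f f₁ f₂
  open SplitProperties _≟ᴵ_ _≟ᶜ_ P o f f₁ f₂
  open Stable S-stable renaming (S0 to individually-rational; Sstar to blocked)
  open ≡-Reasoning

  S₀ : Sub C
  S₀ = (P at S) o

  S̃at : Ĩ → Sub C̃
  S̃at = P̃ at S̃ S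

  fk-plott : ∀ k → IsPlottOn C0 (fk k)
  fk-plott one = f₁-plott
  fk-plott two = f₂-plott

  S-at-⊆ : ∀ j → (P at S) j ⊆ (λ c → P c j)
  S-at-⊆ j c c∈Sⱼ = ∧-conicalʳ (S c) (P c j) c∈Sⱼ

  fk-S₀⊆S₀ : ∀ k → fk k S₀ ⊆ S₀
  fk-S₀⊆S₀ k = PlottOn.contracting (fk-plott k) S₀ (S-at-⊆ o)

  fk-S₀⊆C0 : ∀ k → fk k S₀ ⊆ C0
  fk-S₀⊆C0 k = PlottOn.f⊆D (fk-plott k) (S-at-⊆ o)

  f₁S₀∪f₂S₀≐S₀ : f₁ S₀ ∪ f₂ S₀ ≐ S₀
  f₁S₀∪f₂S₀≐S₀ c = trans (sym (f₀≐f₁∪f₂ S₀ (S-at-⊆ o) c)) (individually-rational o c)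

  πimg-S̃-old : ∀ j j≢o → πimg (S̃at (inj₁ (j , j≢o))) ≐ (P at S) j
  πimg-S̃-old j j≢o c with side (C0 c)
  ... | outside p = πimg-outside _ c p
  ... | inside p = begin
    πimg (S̃at (inj₁ (j , j≢o))) c                 ≡⟨ πimg-inside _ c p ⟩
    (f₁ S₀ c ∧ P c j) ∨ (f₂ S₀ c ∧ P c j)         ≡⟨ ∧-distribʳ-∨ (P c j) (f₁ S₀ c) (f₂ S₀ c) ⟨
    (f₁ S₀ c ∨ f₂ S₀ c) ∧ P c j                   ≡⟨ cong (_∧ P c j) (f₁S₀∪f₂S₀≐S₀ c) ⟩
    (S c ∧ P c o) ∧ P c j                         ≡⟨ cong (λ b → (S c ∧ b) ∧ P c j) c∈C0 ⟩
    (S c ∧ true) ∧ P c j                          ≡⟨ cong (_∧ P c j) (∧-identityʳ (S c)) ⟩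
    S c ∧ P c j                                   ∎
    where
    c∈C0 : C0 c ≡ true
    c∈C0 = Equivalence.to T-≡ p

  S̃-old⊆π⁻¹S : ∀ j j≢o → S̃at (inj₁ (j , j≢o)) ⊆ πpre ((P at S) j)
  S̃-old⊆π⁻¹S j j≢o (inj₁ _) x∈S̃ⱼ = x∈S̃ⱼ
  S̃-old⊆π⁻¹S j j≢o (inj₂ ((c , _) , k)) x∈S̃ⱼ =
    cong₂ _∧_ c∈S (∧-conicalʳ (fk k S₀ c) (P c j) x∈S̃ⱼ)
    where
    c∈S : S c ≡ true
    c∈S = ∧-conicalˡ (S c) (P c o) (fk-S₀⊆S₀ k c (∧-conicalˡ (fk k S₀ c) (P c j) x∈S̃ⱼ))

  S̃-old-fixed : ∀ j j≢o → f̃ (inj₁ (j , j≢o)) (S̃at (inj₁ (j , j≢o))) ≐ S̃at (inj₁ (j , j≢o))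
  S̃-old-fixed j j≢o x =
    trans (cong (S̃at (inj₁ (j , j≢o)) x ∧_) (S-fixed (π x))) (⊆⇒∩≐ (S̃-old⊆π⁻¹S j j≢o) x)
    where
    S-fixed : f j (πimg (S̃at (inj₁ (j , j≢o)))) ≐ (P at S) j
    S-fixed c = trans (PlottOn.f-cong (f-plott j) (πimg-S̃-old j j≢o) (S-at-⊆ j) c)
                      (individually-rational j c)

  fk-S₀-outside : ∀ k c → T (not (C0 c)) → fk k S₀ c ≡ false
  fk-S₀-outside k c c∉C0 with fk k S₀ c in e
  ... | true  = ⊥-elim (T-not-T (Equivalence.from T-≡ (fk-S₀⊆C0 k c e)) c∉C0)
  ... | false = refl

  πimg-S̃-new : ∀ k → πimg (S̃at (inj₂ k)) ≐ fk k S₀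
  πimg-S̃-new k c with side (C0 c)
  πimg-S̃-new one c | inside p = trans (πimg-inside _ c p)
    (trans (cong₂ _∨_ (∧-identityʳ (f₁ S₀ c)) (∧-zeroʳ (f₂ S₀ c))) (∨-identityʳ (f₁ S₀ c)))
  πimg-S̃-new two c | inside p = trans (πimg-inside _ c p)
    (cong₂ _∨_ (∧-zeroʳ (f₁ S₀ c)) (∧-identityʳ (f₂ S₀ c)))
  πimg-S̃-new k c | outside p = trans (πimg-outside _ c p)
    (trans (∧-zeroʳ (S c)) (sym (fk-S₀-outside k c p)))

  fk-S₀-fixed : ∀ k → fk k (πimg (S̃at (inj₂ k))) ≐ fk k S₀
  fk-S₀-fixed k c = trans (PlottOn.f-cong (fk-plott k) (πimg-S̃-new k) (fk-S₀⊆C0 k) c)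
                          (PlottOn.f-idem (fk-plott k) (S-at-⊆ o) c)

  S̃-new-fixed : ∀ k → f̃ (inj₂ k) (S̃at (inj₂ k)) ≐ S̃at (inj₂ k)
  S̃-new-fixed k (inj₁ (c , _)) = sym (∧-zeroʳ (S c))
  S̃-new-fixed one (inj₂ ((c , _) , one)) = trans (fk-S₀-fixed one c) (sym (∧-identityʳ _))
  S̃-new-fixed one (inj₂ ((c , _) , two)) = sym (∧-zeroʳ _)
  S̃-new-fixed two (inj₂ ((c , _) , one)) = sym (∧-zeroʳ _)
  S̃-new-fixed two (inj₂ ((c , _) , two)) = trans (fk-S₀-fixed two c) (sym (∧-identityʳ _))

  S̃-fixed : ∀ i → f̃ i (S̃at i) ≐ S̃at i
  S̃-fixed (inj₁ (j , j≢o)) = S̃-old-fixed j j≢o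
  S̃-fixed (inj₂ k)         = S̃-new-fixed k

  Blocked : C̃ → Set
  Blocked b = ∃ λ i → P̃ b i ≡ true × f̃ i (S̃at i ∪ ⁅ C̃-≟ ⁆ b) b ≡ false

  blocked-by-old : ∀ b j (j≢o : T (not ⌊ j ≟ᴵ o ⌋)) → P (π b) j ≡ true →
                   f j ((P at S) j ∪ ⁅ _≟ᶜ_ ⁆ (π b)) (π b) ≡ false → Blocked b
  blocked-by-old b j j≢o πb∈Cⱼ rejected =
    inj₁ (j , j≢o) , trans (P̃-old b j j≢o) πb∈Cⱼ , trans (cong (X b ∧_) rejected′) (∧-zeroʳ _)
    where
    X : Sub C̃
    X = S̃at (inj₁ (j , j≢o)) ∪ ⁅ C̃-≟ ⁆ b
    πimg≐ : πimg X ≐ (P at S) j ∪ ⁅ _≟ᶜ_ ⁆ (π b)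
    πimg≐ c = trans (πimg-∪ _ _ c) (cong₂ _∨_ (πimg-S̃-old j j≢o c) (πimg-⁅⁆ b c))
    rejected′ : f j (πimg X) (π b) ≡ false
    rejected′ = trans (PlottOn.f-cong (f-plott j) πimg≐ (∪-least (S-at-⊆ j) ⁅πb⁆⊆Cⱼ) (π b)) rejected
      where
      ⁅πb⁆⊆Cⱼ : ⁅ _≟ᶜ_ ⁆ (π b) ⊆ (λ c → P c j)
      ⁅πb⁆⊆Cⱼ = x∈D⇒⁅x⁆⊆D _≟ᶜ_ πb∈Cⱼ

  blocked-by-copy : ∀ c p k → fk k (S₀ ∪ ⁅ _≟ᶜ_ ⁆ c) c ≡ false → Blocked (copy c p k)
  blocked-by-copy c p k rejected =
    inj₂ k , ==ᶜ-refl k , trans (cong ((k ==ᶜ k) ∧_) rejected′) (∧-zeroʳ _)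
    where
    ⁅c⁆⊆C0 : ⁅ _≟ᶜ_ ⁆ c ⊆ C0
    ⁅c⁆⊆C0 = x∈D⇒⁅x⁆⊆D _≟ᶜ_ (Equivalence.to T-≡ p)
    πimg≐ : πimg (S̃at (inj₂ k) ∪ ⁅ C̃-≟ ⁆ (copy c p k)) ≐ fk k S₀ ∪ ⁅ _≟ᶜ_ ⁆ c
    πimg≐ d = trans (πimg-∪ _ _ d) (cong₂ _∨_ (πimg-S̃-new k d) (πimg-⁅⁆ (copy c p k) d))
    rejected′ : fk k (πimg (S̃at (inj₂ k) ∪ ⁅ C̃-≟ ⁆ (copy c p k))) c ≡ false
    rejected′ = begin
      fk k (πimg (S̃at (inj₂ k) ∪ ⁅ C̃-≟ ⁆ (copy c p k))) c
        ≡⟨ PlottOn.f-cong (fk-plott k) πimg≐ (∪-least (fk-S₀⊆C0 k) ⁅c⁆⊆C0) c ⟩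
      fk k (fk k S₀ ∪ ⁅ _≟ᶜ_ ⁆ c) c
        ≡⟨ IsPlottOn.plott (fk-plott k) S₀ (⁅ _≟ᶜ_ ⁆ c) (S-at-⊆ o) ⁅c⁆⊆C0 c ⟨
      fk k (S₀ ∪ ⁅ _≟ᶜ_ ⁆ c) c
        ≡⟨ rejected ⟩
      false ∎

  f₀-rejects⇒fk-rejects : ∀ {A} c k → A ⊆ C0 → f o A c ≡ false → fk k A c ≡ false
  f₀-rejects⇒fk-rejects {A} c one A⊆C0 rejected =
    ∨-conicalˡ (f₁ A c) (f₂ A c) (trans (sym (f₀≐f₁∪f₂ A A⊆C0 c)) rejected)
  f₀-rejects⇒fk-rejects {A} c two A⊆C0 rejected =
    ∨-conicalʳ (f₁ A c) (f₂ A c) (trans (sym (f₀≐f₁∪f₂ A A⊆C0 c)) rejected)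

  S̃-blocked : ∀ b → S̃ S b ≡ false → Blocked b
  S̃-blocked (inj₁ (c , c∉C0)) c∉S with blocked c c∉S
  ... | i , c∈Cᵢ , rejected with i ≟ᴵ o
  ...   | yes refl = ⊥-elim (T-not-T (Equivalence.from T-≡ c∈Cᵢ) c∉C0)
  ...   | no i≢o   = blocked-by-old _ i (fromWitnessFalse i≢o) c∈Cᵢ rejected
  S̃-blocked (inj₂ ((c , c∈C0) , k)) c∉S̃ with S c in S∋c
  ... | true = blocked-by-copy c c∈C0 k
                 (trans (PlottOn.f-cong (fk-plott k) (x∈A⇒A∪⁅x⁆≐A _≟ᶜ_ c∈S₀) (S-at-⊆ o) c) c∉S̃)
    where
    c∈S₀ : c ∈ S₀
    c∈S₀ = cong₂ _∧_ S∋c (Equivalence.to T-≡ c∈C0)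
  ... | false with blocked c S∋c
  ...   | i , c∈Cᵢ , rejected with i ≟ᴵ o
  ...     | no i≢o   = blocked-by-old _ i (fromWitnessFalse i≢o) c∈Cᵢ rejected
  ...     | yes refl = blocked-by-copy c c∈C0 k
                         (f₀-rejects⇒fk-rejects c k S₀∪⁅c⁆⊆C0 rejected)
    where
    S₀∪⁅c⁆⊆C0 : S₀ ∪ ⁅ _≟ᶜ_ ⁆ c ⊆ C0
    S₀∪⁅c⁆⊆C0 = ∪-least (S-at-⊆ o) (x∈D⇒⁅x⁆⊆D _≟ᶜ_ c∈Cᵢ)

  S̃-stable : Stable C̃-≟ P̃ f̃ (S̃ S)
  S̃-stable = record { S0 = S̃-fixed ; Sstar = S̃-blocked }

proposition3p3 : {I C : Set} →
    IsFinite I → IsFinite C →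
    (_≟ᴵ_ : DecidableEquality I) (_≟ᶜ_ : DecidableEquality C) →
    (P : C → Sub I) →
    (∀ c → ∃ λ i → P c i ≡ true) →
    (f : I → Sub C → Sub C) →
    (∀ i → IsPlottOn (λ c → P c i) (f i)) →
    (o : I) (f₁ f₂ : Sub C → Sub C) →
    IsPlottOn (λ c → P c o) f₁ →
    IsPlottOn (λ c → P c o) f₂ →
    (∀ A → A ⊆ (λ c → P c o) → f o A ≐ (f₁ A ∪ f₂ A)) →
    (S : Sub C) →
    Stable _≟ᶜ_ P f S →
    Stable (Split.C̃-≟ _≟ᴵ_ _≟ᶜ_ P o f f₁ f₂) (Split.P̃ _≟ᴵ_ _≟ᶜ_ P o f f₁ f₂)
           (Split.f̃ _≟ᴵ_ _≟ᶜ_ P o f f₁ f₂) (Split.S̃ _≟ᴵ_ _≟ᶜ_ P o f f₁ f₂ S)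
proposition3p3 _ _ _≟ᴵ_ _≟ᶜ_ P _ f f-plott o f₁ f₂ f₁-plott f₂-plott f₀≐f₁∪f₂ S S-stable =
  SplitOfStable.S̃-stable _≟ᴵ_ _≟ᶜ_ P f f-plott o f₁ f₂ f₁-plott f₂-plott f₀≐f₁∪f₂ S S-stable
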